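{- Let $G$ be a connected graph and let $t\geq 2$ be an integer. Then $2\leq \rho_{e}^o(G)\leq t$ if and only if $G$ satisfies all of the following conditions. \begin{itemize} \item $(C_1)$: $2\leq \operatorname{diam}(G)\leq 2t$. \item $(C_2)$: for every integer $s\geq t+1$, $G$ is $K_{1,s}$-free, i.e. $G$ contains no induced subgraph isomorphic to the star $K_{1,s}$. \item $(C_3)$: for every induced matching $M$ of $G$ with $|M|=t$ (if one exists), every vertex $z\in V(G)\setminus V(G[M])$ is adjacent to at least two vertices of $V(G[M])$. \item $(C_4)$: if $t\geq 3$, then for every $s$ with $2\leq s\leq t-1$, every partition $\{r_1,\dots,r_s\}$ of $t$ into $s$ parts with $1\leq r_1\leq r_2\leq\cdots\leq r_s$, and every edge open packing set $D^s$ of $G$ with $|D^s|=t$ such that $G[D^s]=D_1\cup D_2\cup\cdots\cup D_s$ where $D_1,\dots,D_s$ are the components of $G[D^s]$ and $D_i\cong K_{1,r_i}$ for each $i$, the following holds: for every vertex $z\in V(G)\setminus V(G[D^s])$ that is adjacent to the centre vertex $u_j$ of some component $D_j$ (if $D_j$ has only one edge, one of its end vertices is regarded as its centre), $z$ is adjacent to at least one vertex of $V(G[D^s])\setminus\{u_j\}$. \end{itemize}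
   Context: All graphs are finite and simple. For a graph $G$ and edges $e_1,e_2\in E(G)$, an edge $e\neq e_1,e_2$ is a common edge of $e_1$ and $e_2$ if $e$ joins an endpoint of $e_1$ to an endpoint of $e_2$. A set $D\subseteq E(G)$ is an edge open packing (EOP) set if no two distinct edges of $D$ have a common edge in $G$ (equivalently, for any two edges $e_1,e_2\in D$ there is no edge $e\in E(G)\setminus\{e_1,e_2\}$ such that the subgraph formed by $e_1,e,e_2$ is $P_4$ or $C_3$). The edge open packing number $\rho_e^o(G)$ is the maximum size of an EOP set of $G$. For $B\subseteq E(G)$, $G[B]$ denotes the subgraph of $G$ induced by the set of endpoints of edges in $B$. An induced matching is a matching $M$ such that no two edges of $M$ are joined by an edge of $G$. $\operatorname{diam}(G)$ is the diameter of $G$. -}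

module Defs where

open import Level using (0ℓ)
open import Data.Nat using (ℕ; zero; suc; _≤_; _+_; _*_; _∸_)
open import Data.Fin as Fin using (Fin)
open import Data.Vec using (Vec; lookup; sum)
open import Data.List using (List; length)
open import Data.List.Relation.Unary.Any using (Any)
open import Data.List.Relation.Unary.AllPairs using (AllPairs)
open import Data.Product using (Σ; ∃; ∃-syntax; _×_; _,_)
open import Data.Sum using (_⊎_)
open import Data.Unit using (⊤)
open import Relation.Nullary using (¬_)
open import Relation.Binary using (Decidable)
open import Relation.Binary.PropositionalEquality using (_≡_; _≢_)
open import Function.Bundles using (_⇔_)

record Graph : Set₁ where
  field
    n      : ℕ
    Adj    : Fin n → Fin n → Set
    adj?   : Decidable Adj
    sym    : ∀ {x y} → Adj x y → Adj y x
    irrefl : ∀ {x} → ¬ Adj x x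

module _ (G : Graph) where
  open Graph G

  data WalkIn (P : Fin n → Set) : Fin n → Fin n → ℕ → Set where
    nil  : ∀ {x} → P x → WalkIn P x x 0
    cons : ∀ {x y z k} → P x → Adj x y → WalkIn P y z k → WalkIn P x z (suc k)

  Walk : Fin n → Fin n → ℕ → Set
  Walk = WalkIn (λ _ → ⊤)

  Connected : Set
  Connected = ∀ x y → ∃[ k ] Walk x y k

  DistLe : Fin n → Fin n → ℕ → Set
  DistLe x y k = ∃[ m ] (m ≤ k × Walk x y m)

  -- diam(G) ≤ k  and  k ≤ diam(G)  (k ≥ 1), for connected G
  DiamLe : ℕ → Set
  DiamLe k = ∀ x y → DistLe x y k

  DiamGe : ℕ → Set
  DiamGe k = ∃[ x ] ∃[ y ] ¬ DistLe x y (k ∸ 1)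

  -- an edge {u,v}, stored with u < v
  record Edge : Set where
    constructor mkEdge
    field
      u   : Fin n
      v   : Fin n
      u<v : u Fin.< v
      adj : Adj u v
  open Edge public

  _≈E_ : Edge → Edge → Set
  e ≈E f = u e ≡ u f × v e ≡ v f

  _∈E_ : Fin n → Edge → Set
  x ∈E e = x ≡ u e ⊎ x ≡ v e

  IsEdge : Fin n → Fin n → Edge → Set
  IsEdge x y e = (x ≡ u e × y ≡ v e) ⊎ (x ≡ v e × y ≡ u e)

  CommonEdge : Edge → Edge → Set
  CommonEdge e f = ∃[ x ] ∃[ y ]
    (x ∈E e × y ∈E f × Adj x y × ¬ IsEdge x y e × ¬ IsEdge x y f)

  EOP : List Edge → Set
  EOP D = AllPairs (λ e f → ¬ (e ≈E f) × ¬ CommonEdge e f) D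

  InV : List Edge → Fin n → Set
  InV B x = Any (x ∈E_) B

  InducedMatching : List Edge → Set
  InducedMatching M = AllPairs
    (λ e f → (∀ x → x ∈E e → ¬ x ∈E f) ×
             (∀ x y → x ∈E e → y ∈E f → ¬ Adj x y)) M

  HasInducedStar : ℕ → Set
  HasInducedStar s = ∃[ c ] Σ (Fin s → Fin n) λ ℓ →
    ((∀ i j → ℓ i ≡ ℓ j → i ≡ j) ×
     (∀ i → Adj c (ℓ i)) ×
     (∀ i j → ¬ Adj (ℓ i) (ℓ j)))


  StarAdj : ∀ {r} → Fin (suc r) → Fin (suc r) → Set
  StarAdj k l = (k ≡ Fin.zero × l ≢ Fin.zero) ⊎ (k ≢ Fin.zero × l ≡ Fin.zero)

  -- G[D] = D_1 ∪ … ∪ D_s where D_1,…,D_s are the components of G[D]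
  -- and D_i ≅ K_{1,r_i} via the isomorphism iso i (centre = iso i zero)
  record StarComponents (D : List Edge) (s : ℕ) (r : Vec ℕ s) : Set where
    field
      comp      : Fin n → Fin s
      sameComp  : ∀ x y → InV D x → InV D y →
                  (comp x ≡ comp y) ⇔ (∃[ k ] WalkIn (InV D) x y k)
      iso       : (i : Fin s) → Fin (suc (lookup r i)) → Fin n
      iso-inj   : ∀ i k l → iso i k ≡ iso i l → k ≡ l
      iso-in    : ∀ i k → InV D (iso i k) × comp (iso i k) ≡ i
      iso-onto  : ∀ x → InV D x → ∃[ k ] iso (comp x) k ≡ x
      iso-adj   : ∀ i k l → Adj (iso i k) (iso i l) ⇔ StarAdj k l

    centre : Fin s → Fin n
    centre i = iso i Fin.zero

  C1 : ℕ → Set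
  C1 t = DiamGe 2 × DiamLe (2 * t)

  C2 : ℕ → Set
  C2 t = ∀ s → suc t ≤ s → ¬ HasInducedStar s

  C3 : ℕ → Set
  C3 t = ∀ M → InducedMatching M → length M ≡ t →
         ∀ z → ¬ InV M z →
         ∃[ x ] ∃[ y ] (x ≢ y × InV M x × InV M y × Adj z x × Adj z y)

  C4 : ℕ → Set
  C4 t = 3 ≤ t →
    ∀ s → 2 ≤ s → s ≤ t ∸ 1 →
    ∀ (r : Vec ℕ s) → (∀ i → 1 ≤ lookup r i) →
    (∀ i j → i Fin.≤ j → lookup r i ≤ lookup r j) → sum r ≡ t →
    ∀ D → EOP D → length D ≡ t →
    (S : StarComponents D s r) →
    let open StarComponents S in
    ∀ j z → ¬ InV D z → Adj z (centre j) →
    ∃[ w ] (InV D w × w ≢ centre j × Adj z w)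

  -- 2 ≤ ρ_e^o(G) ≤ t  (ρ_e^o is the maximum size of an EOP set)
  RhoBetween : ℕ → ℕ → Set
  RhoBetween a t = (∃[ D ] (EOP D × a ≤ length D)) × (∀ D → EOP D → length D ≤ t)

-- (⇒) Each condition can only fail in the presence of an EOP set of size t + 1: a geodesic of length
-- 2t + 1 contains one, an induced K_{1,s} is one, and an outside vertex violating (C3) or (C4)
-- extends the EOP set in question by an edge. Two packed edges give two vertices at distance ≥ 2.
-- (⇐) An induced path x c d gives two packed edges. Conversely let D be EOP with t + 1 edges. If no
-- vertex is shared by two edges, D minus an edge e is an induced matching of size t in which u e has
-- at most one neighbour, against (C3). Otherwise some w is shared by e₁ = wa and another edge; in
-- D ∖ e₁ the vertex a is outside with w as its only neighbour. If D ∖ e₁ has no shared vertex this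
-- contradicts (C3); if all its edges contain w, D is an induced K_{1,t+1}, against (C2); otherwise
-- D ∖ e₁ is a star forest with 2 ≤ s ≤ t − 1 components, with w a centre, and (C4) is violated.

module Submission where

open import Defs
open import Data.Empty using (⊥; ⊥-elim)
open import Data.Unit using (tt)
open import Data.Nat as ℕ using (ℕ; zero; suc; _≤_; z≤n; s≤s; _+_; _*_)
import Data.Nat.Properties as ℕP
open import Data.Nat.ListAction using (sum)
open import Data.Nat.ListAction.Properties using (sum-↭)
open import Data.Fin as F using (Fin)
import Data.Fin.Properties as FP
open import Data.Vec as V using (Vec)
import Data.Vec.Properties as VP
open import Data.Product using (∃; ∃-syntax; _×_; _,_; proj₁; proj₂)
open import Data.Product.Relation.Binary.Lex.NonStrict using (×-decTotalOrder)
open import Data.Sum using (_⊎_; inj₁; inj₂; [_,_])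
open import Data.List as L using (List; []; _∷_; length; filter)
import Data.List.Properties as LP
open import Data.List.Relation.Unary.Any as Any using (Any; here; there)
import Data.List.Relation.Unary.Any.Properties as AnyP
open import Data.List.Relation.Unary.All as All using (All; []; _∷_)
import Data.List.Relation.Unary.All.Properties as AllP
open import Data.List.Relation.Unary.AllPairs as AP using (AllPairs; []; _∷_)
import Data.List.Relation.Unary.AllPairs.Properties as APP
open import Data.List.Relation.Unary.Sorted.TotalOrder.Properties using (Sorted⇒AllPairs)
open import Data.List.Membership.Propositional using (_∈_; _∉_; find; lose)
import Data.List.Membership.Propositional.Properties as ∈P
import Data.List.Membership.DecPropositional as DecMembership
open import Data.List.Relation.Binary.Permutation.Propositional using (_↭_; ↭-sym; ↭⇒↭ₛ)
import Data.List.Relation.Binary.Permutation.Propositional.Properties as ↭P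
import Data.List.Relation.Binary.Permutation.Setoid.Properties as ↭ₛP
open import Function using (_∘_)
open import Function.Bundles using (_⇔_; mk⇔; Equivalence)
open import Relation.Nullary using (¬_; Dec; yes; no; ¬?)
open import Relation.Nullary.Decidable using (_×-dec_; _⊎-dec_; decidable-stable)
open import Relation.Binary using (Symmetric; tri<; tri≈; tri>)
open import Relation.Binary.Bundles using (DecTotalOrder)
open import Relation.Binary.Definitions using (DecidableEquality)
import Relation.Binary.Construct.On as On
open import Relation.Binary.PropositionalEquality
  using (_≡_; _≢_; refl; sym; trans; cong; cong₂; subst; subst₂; resp₂; setoid; module ≡-Reasoning)

module _ {A : Set} where

  AllPairs-∈ : ∀ {R : A → A → Set} {xs a b} → AllPairs R xs → a ∈ xs → b ∈ xs →
               a ≡ b ⊎ R a b ⊎ R b a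
  AllPairs-∈ (_ ∷ _)    (here refl) (here refl) = inj₁ refl
  AllPairs-∈ (px ∷ _)   (here refl) (there q)   = inj₂ (inj₁ (All.lookup px q))
  AllPairs-∈ (px ∷ _)   (there p)   (here refl) = inj₂ (inj₂ (All.lookup px p))
  AllPairs-∈ (_ ∷ pxs)  (there p)   (there q)   = AllPairs-∈ pxs p q

  AllPairs-lookup-< : ∀ {R : A → A → Set} {xs} → AllPairs R xs → ∀ {i j} → i F.< j →
                      R (L.lookup xs i) (L.lookup xs j)
  AllPairs-lookup-< (px ∷ _)  {F.zero}  {F.suc j} _         = All.lookup px (∈P.∈-lookup j)
  AllPairs-lookup-< (_ ∷ pxs) {F.suc i} {F.suc j} (s≤s i<j) = AllPairs-lookup-< pxs i<j

  AllPairs-lookup-injective : ∀ {R S : A → A → Set} → (∀ {a b} → R a b → ¬ S a b) → Symmetric S →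
                              ∀ {xs} → AllPairs R xs → ∀ i j →
                              S (L.lookup xs i) (L.lookup xs j) → i ≡ j
  AllPairs-lookup-injective R⇒¬S S-sym ap i j s with FP.<-cmp i j
  ... | tri< i<j _ _ = ⊥-elim (R⇒¬S (AllPairs-lookup-< ap i<j) s)
  ... | tri≈ _ i≡j _ = i≡j
  ... | tri> _ _ j<i = ⊥-elim (R⇒¬S (AllPairs-lookup-< ap j<i) (S-sym s))

  1≤length⇒∃∈ : ∀ {xs : List A} → 1 ≤ length xs → ∃[ x ] x ∈ xs
  1≤length⇒∃∈ {x ∷ _} _ = x , here refl

  ∈⇒↭-front : ∀ {x : A} {xs} → x ∈ xs → ∃[ ys ] (xs ↭ x ∷ ys)
  ∈⇒↭-front {x} x∈ with ∈P.∈-∃++ x∈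
  ... | ys , zs , refl = ys L.++ zs , ↭P.shift x ys zs

  distinct-∈⇒2≤length : ∀ {xs : List A} {a b} → a ∈ xs → b ∈ xs → a ≢ b → 2 ≤ length xs
  distinct-∈⇒2≤length (here refl) (here refl)       a≢b = ⊥-elim (a≢b refl)
  distinct-∈⇒2≤length (here refl) (there b∈)        _   = s≤s (∈P.∈-length b∈)
  distinct-∈⇒2≤length (there a∈)  (here refl)       _   = s≤s (∈P.∈-length a∈)
  distinct-∈⇒2≤length (there a∈)  (there b∈)        a≢b =
    ℕP.m≤n⇒m≤1+n (distinct-∈⇒2≤length a∈ b∈ a≢b)

module _ {A B : Set} (_≟_ : DecidableEquality B) (f : A → B) where

  fibre : B → List A → List A
  fibre b = filter (λ a → f a ≟ b)

  private
    fibreSizes : List A → List B → ℕ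
    fibreSizes as bs = sum (L.map (λ b → length (fibre b as)) bs)

    fibreSizes-[] : ∀ bs → fibreSizes [] bs ≡ 0
    fibreSizes-[] []       = refl
    fibreSizes-[] (_ ∷ bs) = fibreSizes-[] bs

    fibreSizes-∉ : ∀ a as bs → f a ∉ bs → fibreSizes (a ∷ as) bs ≡ fibreSizes as bs
    fibreSizes-∉ a as []       _     = refl
    fibreSizes-∉ a as (b ∷ bs) fa∉ = cong₂ _+_
      (cong length (LP.filter-reject (λ a → f a ≟ b) (λ fa≡b → fa∉ (here fa≡b))))
      (fibreSizes-∉ a as bs (λ fa∈ → fa∉ (there fa∈)))

    fibreSizes-∈ : ∀ a as {bs} → AllPairs _≢_ bs → f a ∈ bs → fibreSizes (a ∷ as) bs ≡ suc (fibreSizes as bs)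
    fibreSizes-∈ a as {b ∷ bs} (b∉ ∷ _) (here refl) = cong₂ _+_
      (cong length (LP.filter-accept (λ a → f a ≟ b) refl))
      (fibreSizes-∉ a as bs (λ fa∈ → All.lookup b∉ fa∈ refl))
    fibreSizes-∈ a as {b ∷ bs} (b∉ ∷ ubs) (there fa∈) = trans (cong₂ _+_
      (cong length (LP.filter-reject (λ a → f a ≟ b) (λ { refl → All.lookup b∉ fa∈ refl })))
      (fibreSizes-∈ a as ubs fa∈)) (ℕP.+-suc _ _)

  sum-fibres : ∀ {bs} → AllPairs _≢_ bs → ∀ as → All (λ a → f a ∈ bs) as →
               sum (L.map (λ b → length (fibre b as)) bs) ≡ length as
  sum-fibres {bs} _   []       []          = fibreSizes-[] bs
  sum-fibres      ubs (a ∷ as) (fa∈ ∷ fas) = trans (fibreSizes-∈ a as ubs fa∈) (cong suc (sum-fibres ubs as fas))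

cast-injective : ∀ {a b} .(eq : a ≡ b) {k l : Fin a} → F.cast eq k ≡ F.cast eq l → k ≡ l
cast-injective eq {k} {l} h =
  trans (sym (FP.cast-involutive (sym eq) eq k)) (trans (cong (F.cast (sym eq)) h) (FP.cast-involutive (sym eq) eq l))

2≤-of-distinct : ∀ {s} {i j : Fin s} → i ≢ j → 2 ≤ s
2≤-of-distinct {suc (suc _)}                     _   = s≤s (s≤s z≤n)
2≤-of-distinct {suc zero}    {F.zero} {F.zero} i≢j = ⊥-elim (i≢j refl)

length≤sum : ∀ {s} (r : Vec ℕ s) → (∀ i → 1 ≤ V.lookup r i) → s ≤ V.sum r
length≤sum V.[]      _   = z≤n
length≤sum (x V.∷ r) pos = ℕP.+-mono-≤ (pos F.zero) (length≤sum r (pos ∘ F.suc))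

suc-length≤sum : ∀ {s} (r : Vec ℕ s) → (∀ i → 1 ≤ V.lookup r i) → ∀ j → 2 ≤ V.lookup r j → suc s ≤ V.sum r
suc-length≤sum (x V.∷ r) pos F.zero    x≥2 = ℕP.+-mono-≤ x≥2 (length≤sum r (pos ∘ F.suc))
suc-length≤sum (x V.∷ r) pos (F.suc j) r≥2 = ℕP.+-mono-≤ (pos F.zero) (suc-length≤sum r (pos ∘ F.suc) j r≥2)

sum-tabulate-lookup : ∀ {A : Set} (g : A → ℕ) (xs : List A) →
                      V.sum (V.tabulate (λ i → g (L.lookup xs i))) ≡ sum (L.map g xs)
sum-tabulate-lookup g []       = refl
sum-tabulate-lookup g (x ∷ xs) = cong (g x +_) (sum-tabulate-lookup g xs)

module SortByKey {n} (key : Fin n → ℕ) where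

  private
    order : DecTotalOrder _ _ _
    order = On.decTotalOrder (×-decTotalOrder ℕP.≤-decTotalOrder (FP.≤-decTotalOrder n)) (λ c → key c , c)
    open DecTotalOrder order using (totalOrder) renaming (_≤_ to _⊑_)
    open import Data.List.Sort order using (sort; sort-↭; sort-↗)

    ⊑⇒key≤ : ∀ {a b} → a ⊑ b → key a ≤ key b
    ⊑⇒key≤ (inj₁ (key< , _)) = key<
    ⊑⇒key≤ (inj₂ (key≡ , _)) = ℕP.≤-reflexive key≡

  -- Sorting on the key (key c , c) breaks ties, so that the standard sort for total orders applies.
  sortByKey : List (Fin n) → List (Fin n)
  sortByKey = sort

  sortByKey-↭ : ∀ cs → sortByKey cs ↭ cs
  sortByKey-↭ = sort-↭

  sortByKey-sorted : ∀ cs → AllPairs (λ a b → key a ≤ key b) (sortByKey cs)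
  sortByKey-sorted cs = AP.map ⊑⇒key≤ (Sorted⇒AllPairs totalOrder (sort-↗ cs))

module EdgeFacts (G : Graph) where
  open Graph G public renaming (sym to Adj-sym)

  E : Set
  E = Edge G

  _∈ₑ_ : Fin n → E → Set
  _∈ₑ_ = _∈E_ G

  _≈_ : E → E → Set
  _≈_ = _≈E_ G

  Packed : E → E → Set
  Packed e f = ¬ (e ≈ f) × ¬ CommonEdge G e f

  u≢v : ∀ (e : E) → u e ≢ v e
  u≢v e = FP.<⇒≢ (u<v e)

  _∈ₑ?_ : ∀ x (e : E) → Dec (x ∈ₑ e)
  x ∈ₑ? e = (x FP.≟ u e) ⊎-dec (x FP.≟ v e)

  _≈?_ : ∀ (e f : E) → Dec (e ≈ f)
  e ≈? f = (u e FP.≟ u f) ×-dec (v e FP.≟ v f)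

  InV? : ∀ D x → Dec (InV G D x)
  InV? D x = Any.any? (x ∈ₑ?_) D

  ≈-sym : ∀ (e f : E) → e ≈ f → f ≈ e
  ≈-sym _ _ (p , q) = sym p , sym q

  ≈-trans : ∀ (e f g : E) → e ≈ f → f ≈ g → e ≈ g
  ≈-trans _ _ _ (p , q) (p′ , q′) = trans p p′ , trans q q′

  ∈-resp-≈ : ∀ {x} (e f : E) → e ≈ f → x ∈ₑ e → x ∈ₑ f
  ∈-resp-≈ _ _ (p , _) (inj₁ r) = inj₁ (trans r p)
  ∈-resp-≈ _ _ (_ , q) (inj₂ r) = inj₂ (trans r q)

  endpoints⇒IsEdge : ∀ {x y} (e : E) → x ∈ₑ e → y ∈ₑ e → x ≢ y → IsEdge G x y e
  endpoints⇒IsEdge _ (inj₁ p) (inj₁ q) x≢y = ⊥-elim (x≢y (trans p (sym q)))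
  endpoints⇒IsEdge _ (inj₁ p) (inj₂ q) _   = inj₁ (p , q)
  endpoints⇒IsEdge _ (inj₂ p) (inj₁ q) _   = inj₂ (p , q)
  endpoints⇒IsEdge _ (inj₂ p) (inj₂ q) x≢y = ⊥-elim (x≢y (trans p (sym q)))

  IsEdge⇒∈ˡ : ∀ {x y} (e : E) → IsEdge G x y e → x ∈ₑ e
  IsEdge⇒∈ˡ _ (inj₁ (p , _)) = inj₁ p
  IsEdge⇒∈ˡ _ (inj₂ (p , _)) = inj₂ p

  IsEdge⇒∈ʳ : ∀ {x y} (e : E) → IsEdge G x y e → y ∈ₑ e
  IsEdge⇒∈ʳ _ (inj₁ (_ , q)) = inj₂ q
  IsEdge⇒∈ʳ _ (inj₂ (_ , q)) = inj₁ q

  IsEdge-sym : ∀ {x y} (e : E) → IsEdge G x y e → IsEdge G y x e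
  IsEdge-sym _ (inj₁ (p , q)) = inj₂ (q , p)
  IsEdge-sym _ (inj₂ (p , q)) = inj₁ (q , p)

  IsEdge-endpoint : ∀ {x y w} (e : E) → IsEdge G x y e → w ∈ₑ e → w ≡ x ⊎ w ≡ y
  IsEdge-endpoint _ (inj₁ (p , _)) (inj₁ r) = inj₁ (trans r (sym p))
  IsEdge-endpoint _ (inj₁ (_ , q)) (inj₂ r) = inj₂ (trans r (sym q))
  IsEdge-endpoint _ (inj₂ (_ , q)) (inj₁ r) = inj₂ (trans r (sym q))
  IsEdge-endpoint _ (inj₂ (p , _)) (inj₂ r) = inj₁ (trans r (sym p))

  IsEdge⇒≢ : ∀ {x y} (e : E) → IsEdge G x y e → x ≢ y
  IsEdge⇒≢ e (inj₁ (p , q)) x≡y = u≢v e (trans (sym p) (trans x≡y q))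
  IsEdge⇒≢ e (inj₂ (p , q)) x≡y = u≢v e (trans (sym q) (trans (sym x≡y) p))

  IsEdge⇒Adj : ∀ {x y} (e : E) → IsEdge G x y e → Adj x y
  IsEdge⇒Adj e (inj₁ (refl , refl)) = adj e
  IsEdge⇒Adj e (inj₂ (refl , refl)) = Adj-sym (adj e)

  -- Edges are stored with u < v, so the two orientations cannot both match.
  IsEdge-unique : ∀ {x y} (e f : E) → IsEdge G x y e → IsEdge G x y f → e ≈ f
  IsEdge-unique _ _ (inj₁ (p , q)) (inj₁ (p′ , q′)) = trans (sym p) p′ , trans (sym q) q′
  IsEdge-unique _ _ (inj₂ (p , q)) (inj₂ (p′ , q′)) = trans (sym q) q′ , trans (sym p) p′
  IsEdge-unique e f (inj₁ (refl , refl)) (inj₂ (p′ , q′)) =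
    ⊥-elim (FP.<-asym (subst₂ F._<_ (sym q′) (sym p′) (u<v f)) (u<v e))
  IsEdge-unique e f (inj₂ (refl , refl)) (inj₁ (p′ , q′)) =
    ⊥-elim (FP.<-asym (subst₂ F._<_ (sym p′) (sym q′) (u<v f)) (u<v e))

  shared-endpoints⇒≈ : ∀ {x y} (e f : E) → x ∈ₑ e → y ∈ₑ e → x ≢ y → x ∈ₑ f → y ∈ₑ f → e ≈ f
  shared-endpoints⇒≈ e f xe ye x≢y xf yf =
    IsEdge-unique e f (endpoints⇒IsEdge e xe ye x≢y) (endpoints⇒IsEdge f xf yf x≢y)

  ∉⇒¬IsEdgeˡ : ∀ {x y} (e : E) → ¬ x ∈ₑ e → ¬ IsEdge G x y e
  ∉⇒¬IsEdgeˡ e x∉e i = x∉e (IsEdge⇒∈ˡ e i)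

  ∉⇒¬IsEdgeʳ : ∀ {x y} (e : E) → ¬ y ∈ₑ e → ¬ IsEdge G x y e
  ∉⇒¬IsEdgeʳ e y∉e i = y∉e (IsEdge⇒∈ʳ e i)

  otherEnd : ∀ {x} (e : E) → x ∈ₑ e → ∃[ y ] IsEdge G x y e
  otherEnd e (inj₁ p) = v e , inj₁ (p , refl)
  otherEnd e (inj₂ p) = u e , inj₂ (p , refl)

  edgeOf : ∀ {x y} → Adj x y → E
  edgeOf {x} {y} a with FP.<-cmp x y
  ... | tri< x<y _ _ = mkEdge x y x<y a
  ... | tri≈ _ refl _ = ⊥-elim (irrefl a)
  ... | tri> _ _ y<x = mkEdge y x y<x (Adj-sym a)

  edgeOf-IsEdge : ∀ {x y} (a : Adj x y) → IsEdge G x y (edgeOf a)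
  edgeOf-IsEdge {x} {y} a with FP.<-cmp x y
  ... | tri< _ _ _ = inj₁ (refl , refl)
  ... | tri≈ _ refl _ = ⊥-elim (irrefl a)
  ... | tri> _ _ _ = inj₂ (refl , refl)

  ∃-endpoint-∉ : ∀ (e f : E) → ¬ e ≈ f → ∃[ x ] (x ∈ₑ e × ¬ x ∈ₑ f)
  ∃-endpoint-∉ e f e≉f with u e ∈ₑ? f | v e ∈ₑ? f
  ... | no  u∉f | _       = u e , inj₁ refl , u∉f
  ... | yes _   | no  v∉f = v e , inj₂ refl , v∉f
  ... | yes u∈f | yes v∈f = ⊥-elim (e≉f (shared-endpoints⇒≈ e f (inj₁ refl) (inj₂ refl) (u≢v e) u∈f v∈f))

  CommonEdge-sym : ∀ (e f : E) → CommonEdge G e f → CommonEdge G f e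
  CommonEdge-sym e f (x , y , xe , yf , a , ¬xye , ¬xyf) =
    y , x , yf , xe , Adj-sym a , (λ i → ¬xyf (IsEdge-sym f i)) , (λ i → ¬xye (IsEdge-sym e i))

  Packed-sym : ∀ (e f : E) → Packed e f → Packed f e
  Packed-sym e f (e≉f , ¬ce) = (λ q → e≉f (≈-sym f e q)) , (λ c → ¬ce (CommonEdge-sym f e c))

  EOP-CommonEdge⇒≈ : ∀ {D} {e f : E} → EOP G D → e ∈ D → f ∈ D → CommonEdge G e f → e ≈ f
  EOP-CommonEdge⇒≈ {e = e} {f} eop e∈ f∈ c with AllPairs-∈ eop e∈ f∈
  ... | inj₁ refl        = refl , refl
  ... | inj₂ (inj₁ pack) = ⊥-elim (proj₂ pack c)
  ... | inj₂ (inj₂ pack) = ⊥-elim (proj₂ pack (CommonEdge-sym e f c))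

  EOP-≈⇒≡ : ∀ {D} {e f : E} → EOP G D → e ∈ D → f ∈ D → e ≈ f → e ≡ f
  EOP-≈⇒≡ {e = e} {f} eop e∈ f∈ e≈f with AllPairs-∈ eop e∈ f∈
  ... | inj₁ e≡f         = e≡f
  ... | inj₂ (inj₁ pack) = ⊥-elim (proj₁ pack e≈f)
  ... | inj₂ (inj₂ pack) = ⊥-elim (proj₁ pack (≈-sym e f e≈f))

  star⇒Packed : ∀ {c a b} (e f : E) → IsEdge G c a e → IsEdge G c b f → a ≢ b → ¬ Adj a b → Packed e f
  star⇒Packed e f ie if a≢b ¬ab = e≉f , ¬ce
    where
    e≉f : ¬ e ≈ f
    e≉f q with IsEdge-endpoint f if (∈-resp-≈ e f q (IsEdge⇒∈ʳ e ie))
    ... | inj₁ a≡c = IsEdge⇒≢ e ie (sym a≡c)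
    ... | inj₂ a≡b = a≢b a≡b
    ¬ce : ¬ CommonEdge G e f
    ¬ce (x , y , xe , yf , xy , ¬xye , ¬xyf) with IsEdge-endpoint e ie xe | IsEdge-endpoint f if yf
    ... | inj₁ refl | inj₁ refl = irrefl xy
    ... | inj₁ refl | inj₂ refl = ¬xyf if
    ... | inj₂ refl | inj₁ refl = ¬xye (IsEdge-sym e ie)
    ... | inj₂ refl | inj₂ refl = ¬ab xy

  separated⇒Packed : ∀ (e f : E) → (∀ x y → x ∈ₑ e → y ∈ₑ f → x ≢ y × ¬ Adj x y) → Packed e f
  separated⇒Packed e f sep =
    (λ q → proj₁ (sep (u e) (u e) (inj₁ refl) (∈-resp-≈ e f q (inj₁ refl))) refl) ,
    (λ { (x , y , xe , yf , xy , _) → proj₂ (sep x y xe yf) xy })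

module Distance (G : Graph) where
  open EdgeFacts G

  DistLe-mono : ∀ {x y j k} → j ≤ k → DistLe G x y j → DistLe G x y k
  DistLe-mono j≤k (m , m≤j , w) = m , ℕP.≤-trans m≤j j≤k , w

  DistLe-refl : ∀ {y k} → DistLe G y y k
  DistLe-refl = 0 , z≤n , nil tt

  DistLe-step : ∀ {x z y k} → Adj x z → DistLe G z y k → DistLe G x y (suc k)
  DistLe-step xz (m , m≤k , w) = suc m , s≤s m≤k , cons tt xz w

  DistLe-zero : ∀ {x y} → DistLe G x y 0 → x ≡ y
  DistLe-zero (zero , _ , nil _) = refl

  DistLe-suc⁻ : ∀ {x y k} → DistLe G x y (suc k) → x ≡ y ⊎ ∃[ z ] (Adj x z × DistLe G z y k)
  DistLe-suc⁻ (zero , _ , nil _)              = inj₁ refl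
  DistLe-suc⁻ (suc m , s≤s m≤k , cons _ xz w) = inj₂ (_ , xz , m , m≤k , w)

  DistLe-one : ∀ {x y} → DistLe G x y 1 → x ≡ y ⊎ Adj x y
  DistLe-one d with DistLe-suc⁻ d
  ... | inj₁ x≡y           = inj₁ x≡y
  ... | inj₂ (_ , xz , d₀) with DistLe-zero d₀
  ...   | refl = inj₂ xz

  DistLe? : ∀ x y k → Dec (DistLe G x y k)
  DistLe? x y zero with x FP.≟ y
  ... | yes refl = yes DistLe-refl
  ... | no  x≢y  = no (λ d → x≢y (DistLe-zero d))
  DistLe? x y (suc k) with x FP.≟ y | FP.any? (λ z → adj? x z ×-dec DistLe? z y k)
  ... | yes refl | _               = yes DistLe-refl
  ... | no  _    | yes (z , xz , d) = yes (DistLe-step xz d)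
  ... | no  x≢y  | no  ¬step        = no λ d → [ x≢y , ¬step ] (DistLe-suc⁻ d)

  double : ℕ → ℕ
  double zero    = zero
  double (suc k) = suc (suc (double k))

  double≡2* : ∀ k → double k ≡ 2 * k
  double≡2* zero    = refl
  double≡2* (suc k) = trans (cong (λ m → suc (suc m)) (double≡2* k)) (sym (ℕP.*-suc 2 k))

  module Layers (y : Fin n) where

    Beyond : Fin n → ℕ → Set
    Beyond x k = ¬ DistLe G x y k

    Beyond-anti : ∀ {x j k} → j ≤ k → Beyond x k → Beyond x j
    Beyond-anti j≤k bk d = bk (DistLe-mono j≤k d)

    walk⇒exactLayer : ∀ {x k} m → Walk G x y k → Beyond x m → ∃[ v ] (DistLe G v y (suc m) × Beyond v m)
    walk⇒exactLayer m (nil _) b = ⊥-elim (b DistLe-refl)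
    walk⇒exactLayer {x} m (cons {y = x′} _ xx′ w) b with DistLe? x′ y m
    ... | yes d  = x , DistLe-step xx′ d , b
    ... | no  b′ = walk⇒exactLayer m w b′

    Beyond-suc⇒¬Adj : ∀ {a b j} → DistLe G a y j → Beyond b (suc j) → ¬ Adj b a
    Beyond-suc⇒¬Adj d b ba = b (DistLe-step ba d)

    Beyond-suc⇒≢ : ∀ {a b j} → DistLe G a y j → Beyond b (suc j) → b ≢ a
    Beyond-suc⇒≢ d b refl = b (DistLe-mono (ℕP.n≤1+n _) d)

    stepDown : ∀ {v j} → DistLe G v y (suc (suc j)) → Beyond v (suc j) →
               ∃[ w ] (Adj v w × DistLe G w y (suc j) × Beyond w j)
    stepDown d b with DistLe-suc⁻ d
    ... | inj₁ refl          = ⊥-elim (b DistLe-refl)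
    ... | inj₂ (w , vw , dw) = w , vw , dw , (λ d′ → b (DistLe-step vw d′))

    firstLayer⇒Adj : ∀ {v} → DistLe G v y 1 → Beyond v 0 → Adj v y
    firstLayer⇒Adj d b with DistLe-one d
    ... | inj₁ refl = ⊥-elim (b DistLe-refl)
    ... | inj₂ vy   = vy

    far⇒Packed : ∀ {j} e f → (∀ x → x ∈ₑ e → Beyond x (suc j)) → (∀ x → x ∈ₑ f → DistLe G x y j) → Packed e f
    far⇒Packed e f far near = separated⇒Packed e f λ x x′ xe x′f →
      Beyond-suc⇒≢ (near x′ x′f) (far x xe) , Beyond-suc⇒¬Adj (near x′ x′f) (far x xe)

    Ball : List E → ℕ → Set
    Ball D k = ∀ x → InV G D x → DistLe G x y k

    PairEnd : E → E → Fin n → Set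
    PairEnd e₁ e₂ x = x ∈ₑ e₁ ⊎ x ∈ₑ e₂

    geodesicPair : ∀ {j v} → DistLe G v y (suc (suc (suc j))) → Beyond v (suc (suc j)) →
                   ∃[ e₁ ] ∃[ e₂ ] ∃[ v₂ ]
                     (Packed e₁ e₂ × (∀ x → PairEnd e₁ e₂ x → DistLe G x y (suc (suc (suc j))) × Beyond x j) ×
                      DistLe G v₂ y (suc j) × Beyond v₂ j)
    geodesicPair {j} d b with stepDown d b
    ... | v₁ , vv₁ , d₁ , b₁ with stepDown d₁ b₁
    ... | v₂ , v₁v₂ , d₂ , b₂ = e₁ , e₂ , v₂ , packed , ends , d₂ , b₂
      where
      e₁ = edgeOf vv₁
      e₂ = edgeOf v₁v₂
      i₁ = edgeOf-IsEdge vv₁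
      i₂ = edgeOf-IsEdge v₁v₂
      packed : Packed e₁ e₂
      packed = star⇒Packed e₁ e₂ (IsEdge-sym e₁ i₁) i₂ (Beyond-suc⇒≢ d₂ b) (Beyond-suc⇒¬Adj d₂ b)
      up : ∀ {x k} → DistLe G x y k → DistLe G x y (suc k)
      up = DistLe-mono (ℕP.n≤1+n _)
      ends : ∀ x → PairEnd e₁ e₂ x → DistLe G x y (suc (suc (suc j))) × Beyond x j
      ends x (inj₁ xe) with IsEdge-endpoint e₁ i₁ xe
      ... | inj₁ refl = d , Beyond-anti (ℕP.m≤n+m j 2) b
      ... | inj₂ refl = up d₁ , Beyond-anti (ℕP.n≤1+n j) b₁
      ends x (inj₂ xe) with IsEdge-endpoint e₂ i₂ xe
      ... | inj₁ refl = up d₁ , Beyond-anti (ℕP.n≤1+n j) b₁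
      ... | inj₂ refl = up (up d₂) , b₂

    -- Walking down from layer 2t+1 to y, the edges of the geodesic taken two at a time
    -- with a gap of two edges between consecutive pairs form an EOP set of size t + 1.
    layerPacking : ∀ t v → DistLe G v y (suc (double t)) → Beyond v (double t) →
                   ∃[ D ] (EOP G D × length D ≡ suc t × Ball D (suc (double t)))
    layerPacking zero v d b = edgeOf vy ∷ [] , [] ∷ [] , refl , ball
      where
      vy = firstLayer⇒Adj d b
      ball : Ball (edgeOf vy ∷ []) 1
      ball x (here xe) with IsEdge-endpoint (edgeOf vy) (edgeOf-IsEdge vy) xe
      ... | inj₁ refl = d
      ... | inj₂ refl = DistLe-refl
    layerPacking (suc zero) v d b with geodesicPair d b
    ... | e₁ , e₂ , _ , packed , ends , _ = e₁ ∷ e₂ ∷ [] , (packed ∷ []) ∷ [] ∷ [] , refl , ball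
      where
      ball : Ball (e₁ ∷ e₂ ∷ []) 3
      ball x (here xe)         = proj₁ (ends x (inj₁ xe))
      ball x (there (here xe)) = proj₁ (ends x (inj₂ xe))
    layerPacking (suc (suc t)) v d b with geodesicPair d b
    ... | e₁ , e₂ , _ , packed , ends , d₂ , b₂ with stepDown d₂ b₂
    ... | _ , _ , d₃ , b₃ with stepDown d₃ b₃
    ... | v₄ , _ , d₄ , b₄ with layerPacking t v₄ d₄ b₄
    ... | D , eop , len , ballD =
      e₁ ∷ e₂ ∷ D , (packed ∷ All.tabulate (far e₁ inj₁)) ∷ All.tabulate (far e₂ inj₂) ∷ eop ,
      cong (λ m → suc (suc m)) len , ball
      where
      far : ∀ e → (∀ {x} → x ∈ₑ e → PairEnd e₁ e₂ x) → ∀ {f} → f ∈ D → Packed e f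
      far e toPair {f} f∈D =
        far⇒Packed e f (λ x xe → proj₂ (ends x (toPair xe))) (λ x xf → ballD x (lose f∈D xf))
      ball : Ball (e₁ ∷ e₂ ∷ D) (suc (double (suc (suc t))))
      ball x (here xe)         = proj₁ (ends x (inj₁ xe))
      ball x (there (here xe)) = proj₁ (ends x (inj₂ xe))
      ball x (there (there x∈)) = DistLe-mono (ℕP.m≤n+m _ 4) (ballD x x∈)

PackingBound : Graph → ℕ → Set
PackingBound G t = ∀ D → EOP G D → length D ≤ t

bound⇒¬packing : ∀ {G t D} → PackingBound G t → EOP G D → length D ≡ suc t → ⊥
bound⇒¬packing {D = D} bound eop len =
  ℕP.<-irrefl refl (ℕP.≤-trans (ℕP.≤-reflexive (sym len)) (bound D eop))

module Necessity (G : Graph) where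
  open EdgeFacts G
  open Distance G

  DiamGe-of-packing : (∃[ D ] (EOP G D × 2 ≤ length D)) → DiamGe G 2
  DiamGe-of-packing ([] , _ , ())
  DiamGe-of-packing (_ ∷ [] , _ , s≤s ())
  DiamGe-of-packing (e ∷ f ∷ _ , ((e≉f , ¬ce) ∷ _) ∷ _ , _)
    with ∃-endpoint-∉ e f e≉f | ∃-endpoint-∉ f e (λ q → e≉f (≈-sym f e q))
  ... | x , xe , x∉f | y , yf , y∉e = x , y , far
    where
    far : ¬ DistLe G x y 1
    far d with DistLe-one d
    ... | inj₁ refl = x∉f yf
    ... | inj₂ xy   = ¬ce (x , y , xe , yf , xy , ∉⇒¬IsEdgeʳ e y∉e , ∉⇒¬IsEdgeˡ f x∉f)

  DiamLe-of-bound : Connected G → ∀ t → PackingBound G t → DiamLe G (2 * t)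
  DiamLe-of-bound conn t bound x y = subst (DistLe G x y) (double≡2* t) within
    where
    open Layers y
    within : DistLe G x y (double t)
    within with DistLe? x y (double t)
    ... | yes d = d
    ... | no  b with walk⇒exactLayer (double t) (proj₂ (conn x y)) b
    ... | v , d , bv with layerPacking t v d bv
    ... | _ , eop , len , _ = ⊥-elim (bound⇒¬packing bound eop len)

  starPacking : ∀ {s c} (ℓ : Fin s → Fin n) → (∀ i j → ℓ i ≡ ℓ j → i ≡ j) → (cℓ : ∀ i → Adj c (ℓ i)) →
                (∀ i j → ¬ Adj (ℓ i) (ℓ j)) → EOP G (L.tabulate (λ i → edgeOf (cℓ i)))
  starPacking ℓ inj cℓ ¬ℓℓ = APP.tabulate⁺ λ {i} {j} i≢j →
    star⇒Packed (edgeOf (cℓ i)) (edgeOf (cℓ j)) (edgeOf-IsEdge (cℓ i)) (edgeOf-IsEdge (cℓ j))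
                (λ eq → i≢j (inj i j eq)) (¬ℓℓ i j)

  C2-of-bound : ∀ {t} → PackingBound G t → C2 G t
  C2-of-bound {t} bound s t<s (_ , ℓ , inj , cℓ , ¬ℓℓ) =
    ℕP.<-irrefl refl (ℕP.≤-trans t<s (subst (_≤ t) (LP.length-tabulate _) (bound _ (starPacking ℓ inj cℓ ¬ℓℓ))))

  Induced : E → E → Set
  Induced e f = (∀ x → x ∈ₑ e → ¬ x ∈ₑ f) × (∀ x y → x ∈ₑ e → y ∈ₑ f → ¬ Adj x y)

  Induced-sym : ∀ {e f} → Induced e f → Induced f e
  Induced-sym (disj , ¬adj) = (λ x xf xe → disj x xe xf) , (λ x y xf ye xy → ¬adj y x ye xf (Adj-sym xy))

  Induced⇒Packed : ∀ {e f} → Induced e f → Packed e f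
  Induced⇒Packed {e} {f} (disj , ¬adj) =
    separated⇒Packed e f (λ x y xe yf → (λ { refl → disj x xe yf }) , ¬adj x y xe yf)

  InducedMatching⇒EOP : ∀ {M} → InducedMatching G M → EOP G M
  InducedMatching⇒EOP = AP.map (λ {e} {f} → Induced⇒Packed {e} {f})

  extendByPendant : ∀ {M z x} → InducedMatching G M → ¬ InV G M z → InV G M x → (zx : Adj z x) →
                    (∀ y → InV G M y → Adj z y → y ≡ x) → EOP G (edgeOf zx ∷ M)
  extendByPendant {M} im z∉ x∈ zx onlyX = All.tabulate packed ∷ InducedMatching⇒EOP im
    where
    e = edgeOf zx
    ie = edgeOf-IsEdge zx
    packed : ∀ {f} → f ∈ M → Packed e f
    packed {f} f∈M = e≉f , ¬ce
      where
      e≉f : ¬ e ≈ f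
      e≉f q = z∉ (lose f∈M (∈-resp-≈ e f q (IsEdge⇒∈ˡ e ie)))
      ¬ce : ¬ CommonEdge G e f
      ¬ce (a , b , ae , bf , ab , ¬abe , ¬abf) with IsEdge-endpoint e ie ae
      ... | inj₁ refl with onlyX b (lose f∈M bf) ab
      ...   | refl = ¬abe ie
      ¬ce (a , b , ae , bf , ab , ¬abe , ¬abf) | inj₂ refl with find x∈
      ... | g , g∈M , xg with AllPairs-∈ im g∈M f∈M
      ...   | inj₁ refl       = ¬abf (endpoints⇒IsEdge f xg bf (λ { refl → irrefl ab }))
      ...   | inj₂ (inj₁ ind) = proj₂ ind a b xg bf ab
      ...   | inj₂ (inj₂ ind) = proj₂ ind b a bf xg (Adj-sym ab)

  hook : Fin n → E → E
  hook q e with adj? q (u e) | adj? q (v e)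
  ... | yes qu | _      = edgeOf qu
  ... | no  _  | yes qv = edgeOf qv
  ... | no  _  | no  _  = e

  hook-cases : ∀ q e → (∃[ x ] (x ∈ₑ e × IsEdge G q x (hook q e))) ⊎
                       (hook q e ≡ e × ∀ w → w ∈ₑ e → ¬ Adj q w)
  hook-cases q e with adj? q (u e) | adj? q (v e)
  ... | yes qu | _      = inj₁ (u e , inj₁ refl , edgeOf-IsEdge qu)
  ... | no  _  | yes qv = inj₁ (v e , inj₂ refl , edgeOf-IsEdge qv)
  ... | no ¬qu | no ¬qv = inj₂ (refl , λ { w (inj₁ refl) → ¬qu ; w (inj₂ refl) → ¬qv })

  -- If z has no neighbour in V(M), a neighbour q of z becomes the centre of a star made of zq and
  -- the hooked edges of M; together with the untouched edges this is an EOP set of size |M| + 1.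
  extendByHook : ∀ {M z q} → InducedMatching G M → ¬ InV G M z → ¬ InV G M q → (zq : Adj z q) →
                 (∀ x → InV G M x → ¬ Adj z x) → EOP G (edgeOf zq ∷ L.map (hook q) M)
  extendByHook {M} {q = q} im z∉ q∉ zq z↛M =
    AllP.map⁺ (All.tabulate packedZ) ∷ APP.map⁺ (AP.map (λ {e} {f} → packedHooks e f) im)
    where
    ezq = edgeOf zq
    izq = edgeOf-IsEdge zq
    hookedUntouched : ∀ e f → Induced e f → ∀ x → x ∈ₑ e → IsEdge G q x (hook q e) →
                      (∀ w → w ∈ₑ f → ¬ Adj q w) → Packed (hook q e) f
    hookedUntouched e f (disj , ¬adj) x xe iqx q↛f = separated⇒Packed (hook q e) f sep
      where
      sep : ∀ a b → a ∈ₑ hook q e → b ∈ₑ f → a ≢ b × ¬ Adj a b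
      sep a b ae bf with IsEdge-endpoint (hook q e) iqx ae
      ... | inj₁ refl = (λ { refl → ¬adj x b xe bf (Adj-sym (IsEdge⇒Adj (hook q e) iqx)) }) , q↛f b bf
      ... | inj₂ refl = (λ { refl → disj a xe bf }) , ¬adj a b xe bf
    packedHooks : ∀ e f → Induced e f → Packed (hook q e) (hook q f)
    packedHooks e f ind with hook-cases q e | hook-cases q f
    ... | inj₁ (x , xe , ie) | inj₁ (y , yf , if) =
      star⇒Packed (hook q e) (hook q f) ie if (λ { refl → proj₁ ind x xe yf }) (proj₂ ind x y xe yf)
    ... | inj₁ (x , xe , ie) | inj₂ (same , q↛f) =
      subst (Packed (hook q e)) (sym same) (hookedUntouched e f ind x xe ie q↛f)
    ... | inj₂ (same , q↛e) | inj₁ (y , yf , if) =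
      subst (λ g → Packed g (hook q f)) (sym same)
            (Packed-sym (hook q f) e (hookedUntouched f e (Induced-sym {e} {f} ind) y yf if q↛e))
    ... | inj₂ (same , _) | inj₂ (same′ , _) = subst₂ Packed (sym same) (sym same′) (Induced⇒Packed {e} {f} ind)
    packedZ : ∀ {e} → e ∈ M → Packed ezq (hook q e)
    packedZ {e} e∈M with hook-cases q e
    ... | inj₁ (x , xe , ie) =
      star⇒Packed ezq (hook q e) (IsEdge-sym ezq izq) ie (λ { refl → z∉ (lose e∈M xe) }) (z↛M x (lose e∈M xe))
    ... | inj₂ (same , q↛e) = subst (Packed ezq) (sym same) (separated⇒Packed ezq e sep)
      where
      sep : ∀ a b → a ∈ₑ ezq → b ∈ₑ e → a ≢ b × ¬ Adj a b
      sep a b ae be with IsEdge-endpoint ezq izq ae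
      ... | inj₁ refl = (λ { refl → z∉ (lose e∈M be) }) , z↛M b (lose e∈M be)
      ... | inj₂ refl = (λ { refl → q∉ (lose e∈M be) }) , q↛e b be

  connected⇒neighbour : Connected G → ∀ {z w} → z ≢ w → ∃[ q ] Adj z q
  connected⇒neighbour conn {z} {w} z≢w with conn z w
  ... | _ , nil _            = ⊥-elim (z≢w refl)
  ... | _ , cons {y = q} _ zq _ = q , zq

  C3-of-bound : ∀ {t} → Connected G → 1 ≤ t → PackingBound G t → C3 G t
  C3-of-bound conn t≥1 bound M im len z z∉
    with FP.any? (λ x → FP.any? (λ y → ¬? (x FP.≟ y) ×-dec (InV? M x ×-dec (InV? M y ×-dec (adj? z x ×-dec adj? z y)))))
  ... | yes two = two
  ... | no ¬two with FP.any? (λ x → InV? M x ×-dec adj? z x)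
  ...   | yes (x , x∈ , zx) = ⊥-elim (bound⇒¬packing bound (extendByPendant im z∉ x∈ zx onlyX) (cong suc len))
    where
    onlyX : ∀ y → InV G M y → Adj z y → y ≡ x
    onlyX y y∈ zy with y FP.≟ x
    ... | yes y≡x = y≡x
    ... | no  y≢x = ⊥-elim (¬two (y , x , y≢x , y∈ , x∈ , zy , zx))
  ...   | no none with 1≤length⇒∃∈ {xs = M} (subst (1 ≤_) (sym len) t≥1)
  ...     | e₀ , e₀∈M with connected⇒neighbour conn {w = u e₀} (λ { refl → z∉ (lose e₀∈M (inj₁ refl)) })
  ...     | q , zq = ⊥-elim (bound⇒¬packing bound (extendByHook im z∉ q∉ zq z↛M) lenHooked)
    where
    z↛M : ∀ x → InV G M x → ¬ Adj z x
    z↛M x x∈ zx = none (x , x∈ , zx)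
    q∉ : ¬ InV G M q
    q∉ q∈ = z↛M q q∈ zq
    lenHooked : length (edgeOf zq ∷ L.map (hook q) M) ≡ suc _
    lenHooked = cong suc (trans (LP.length-map (hook q) M) len)

  module StarFacts {D s r} (S : StarComponents G D s r) where
    open StarComponents S

    Adj⇒sameComp : ∀ {x y} → InV G D x → InV G D y → Adj x y → comp x ≡ comp y
    Adj⇒sameComp {x} {y} x∈ y∈ xy = Equivalence.from (sameComp x y x∈ y∈) (1 , cons x∈ xy (nil y∈))

    isoIndex : ∀ {x j} → InV G D x → comp x ≡ j → ∃[ k ] iso j k ≡ x
    isoIndex x∈ refl = iso-onto _ x∈

    centreNeighbour⇒spoke : ∀ {j b f} → f ∈ D → b ∈ₑ f → Adj (centre j) b → IsEdge G (centre j) b f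
    centreNeighbour⇒spoke {j} {b} {f} f∈D bf cb with otherEnd f bf
    ... | b′ , ibb′ with isoIndex b∈ compb | isoIndex b′∈ compb′
      where
      b∈ = lose f∈D bf
      b′∈ = lose f∈D (IsEdge⇒∈ʳ f ibb′)
      compb : comp b ≡ j
      compb = trans (sym (Adj⇒sameComp (proj₁ (iso-in j F.zero)) b∈ cb)) (proj₂ (iso-in j F.zero))
      compb′ : comp b′ ≡ j
      compb′ = trans (sym (Adj⇒sameComp b∈ b′∈ (IsEdge⇒Adj f ibb′))) compb
    ... | k , refl | k′ , refl with Equivalence.to (iso-adj j k k′) (IsEdge⇒Adj f ibb′)
    ...   | inj₁ (refl , _) = ⊥-elim (irrefl cb)
    ...   | inj₂ (_ , refl) = IsEdge-sym f ibb′

  extendAtCentre : ∀ {D s r z} (S : StarComponents G D s r) (j : Fin s) → EOP G D → ¬ InV G D z →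
                   (zc : Adj z (StarComponents.centre S j)) →
                   (∀ w → InV G D w → Adj z w → w ≡ StarComponents.centre S j) → EOP G (edgeOf zc ∷ D)
  extendAtCentre {D} S j eop z∉ zc onlyC = All.tabulate packed ∷ eop
    where
    open StarFacts S
    e = edgeOf zc
    ie = edgeOf-IsEdge zc
    packed : ∀ {f} → f ∈ D → Packed e f
    packed {f} f∈D = e≉f , ¬ce
      where
      e≉f : ¬ e ≈ f
      e≉f q = z∉ (lose f∈D (∈-resp-≈ e f q (IsEdge⇒∈ˡ e ie)))
      ¬ce : ¬ CommonEdge G e f
      ¬ce (a , b , ae , bf , ab , ¬abe , ¬abf) with IsEdge-endpoint e ie ae
      ... | inj₁ refl with onlyC b (lose f∈D bf) ab
      ...   | refl = ¬abe ie
      ¬ce (a , b , ae , bf , ab , ¬abe , ¬abf) | inj₂ refl = ¬abf (centreNeighbour⇒spoke f∈D bf ab)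

  C4-of-bound : ∀ {t} → PackingBound G t → C4 G t
  C4-of-bound bound _ s _ _ r _ _ _ D eop len S j z z∉ zc
    with FP.any? (λ w → InV? D w ×-dec (¬? (w FP.≟ StarComponents.centre S j) ×-dec adj? z w))
  ... | yes other = other
  ... | no  none  = ⊥-elim (bound⇒¬packing bound (extendAtCentre S j eop z∉ zc onlyC) (cong suc len))
    where
    onlyC : ∀ w → InV G D w → Adj z w → w ≡ StarComponents.centre S j
    onlyC w w∈ zw with w FP.≟ StarComponents.centre S j
    ... | yes eq  = eq
    ... | no  w≢c = ⊥-elim (none (w , w∈ , w≢c , zw))

module Sufficiency (G : Graph) where
  open EdgeFacts G
  open Distance G
  open Necessity G using (Induced)

  leaveNeighbourhood : ∀ {x y c k} → ¬ DistLe G x y 1 → (c ≡ x ⊎ Adj x c) → Walk G c y k →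
                       ∃[ c ] ∃[ d ] (Adj x c × Adj c d × d ≢ x × ¬ Adj x d)
  leaveNeighbourhood far (inj₁ refl) (nil _) = ⊥-elim (far DistLe-refl)
  leaveNeighbourhood far (inj₂ xc)   (nil _) = ⊥-elim (far (DistLe-step xc DistLe-refl))
  leaveNeighbourhood {x} {c = c} far near (cons {y = d} _ cd w) with d FP.≟ x | adj? x d
  ... | yes d≡x | _      = leaveNeighbourhood far (inj₁ d≡x) w
  ... | no  _   | yes xd = leaveNeighbourhood far (inj₂ xd) w
  ... | no  d≢x | no ¬xd with near
  ...   | inj₁ refl = ⊥-elim (¬xd cd)
  ...   | inj₂ xc   = c , d , xc , cd , d≢x , ¬xd

  packing-of-DiamGe : Connected G → DiamGe G 2 → ∃[ D ] (EOP G D × 2 ≤ length D)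
  packing-of-DiamGe conn (x , y , far) with leaveNeighbourhood far (inj₁ refl) (proj₂ (conn x y))
  ... | c , d , xc , cd , d≢x , ¬xd = e₁ ∷ e₂ ∷ [] , (packed ∷ []) ∷ [] ∷ [] , s≤s (s≤s z≤n)
    where
    e₁ = edgeOf xc
    e₂ = edgeOf cd
    packed : Packed e₁ e₂
    packed = star⇒Packed e₁ e₂ (IsEdge-sym e₁ (edgeOf-IsEdge xc)) (edgeOf-IsEdge cd) (λ x≡d → d≢x (sym x≡d)) ¬xd

  Shared : List E → Fin n → Set
  Shared D x = Any (λ e → x ∈ₑ e × Any (λ f → ¬ e ≈ f × x ∈ₑ f) D) D

  Shared? : ∀ D x → Dec (Shared D x)
  Shared? D x = Any.any? (λ e → (x ∈ₑ? e) ×-dec Any.any? (λ f → ¬? (e ≈? f) ×-dec (x ∈ₑ? f)) D) D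

  shared : ∀ {D e f x} → e ∈ D → f ∈ D → ¬ e ≈ f → x ∈ₑ e → x ∈ₑ f → Shared D x
  shared e∈ f∈ e≉f xe xf = lose e∈ (xe , lose f∈ (e≉f , xf))

  Shared⇒∃ : ∀ {D x} → Shared D x → ∃[ e ] ∃[ f ] (e ∈ D × f ∈ D × ¬ e ≈ f × x ∈ₑ e × x ∈ₑ f)
  Shared⇒∃ sh with find sh
  ... | e , e∈ , xe , sh′ with find sh′
  ...   | f , f∈ , e≉f , xf = e , f , e∈ , f∈ , e≉f , xe , xf

  Shared-⊆ : ∀ {D D′ x} → (∀ {e} → e ∈ D → e ∈ D′) → Shared D x → Shared D′ x
  Shared-⊆ D⊆D′ sh with Shared⇒∃ sh
  ... | _ , _ , e∈ , f∈ , e≉f , xe , xf = shared (D⊆D′ e∈) (D⊆D′ f∈) e≉f xe xf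

  packed-unshared⇒Induced : ∀ {e f} → Packed e f → (∀ x → x ∈ₑ e → ¬ x ∈ₑ f) → Induced e f
  packed-unshared⇒Induced {e} {f} (_ , ¬ce) disj = disj , ¬adj
    where
    ¬adj : ∀ x y → x ∈ₑ e → y ∈ₑ f → ¬ Adj x y
    ¬adj x y xe yf xy = ¬ce (x , y , xe , yf , xy ,
      (λ i → disj y (IsEdge⇒∈ʳ e i) yf) , (λ i → disj x xe (IsEdge⇒∈ˡ f i)))

  unshared⇒InducedMatching : ∀ {D} → EOP G D → (∀ x → ¬ Shared D x) → InducedMatching G D
  unshared⇒InducedMatching {[]}    []          _   = []
  unshared⇒InducedMatching {e ∷ D} (pe ∷ eop) ¬sh =
    All.tabulate induced ∷ unshared⇒InducedMatching eop (λ x sh → ¬sh x (Shared-⊆ there sh))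
    where
    induced : ∀ {f} → f ∈ D → Induced e f
    induced {f} f∈ = packed-unshared⇒Induced {e} {f} (All.lookup pe f∈)
      (λ x xe xf → ¬sh x (shared (here refl) (there f∈) (proj₁ (All.lookup pe f∈)) xe xf))

  EOP-resp-↭ : ∀ {D D′} → D ↭ D′ → EOP G D → EOP G D′
  EOP-resp-↭ p = ↭ₛP.AllPairs-resp-↭ (setoid E) (λ {e} {f} → Packed-sym e f) (resp₂ Packed) (↭⇒↭ₛ p)

  record StarForest (D : List E) (cen : E → Fin n) : Set where
    field
      s          : ℕ
      r          : Vec ℕ s
      r-positive : ∀ i → 1 ≤ V.lookup r i
      r-sorted   : ∀ i j → i F.≤ j → V.lookup r i ≤ V.lookup r j
      r-sum      : V.sum r ≡ length D
      components : StarComponents G D s r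
      centre-comp : ∀ {e} → e ∈ D →
                    StarComponents.centre components (StarComponents.comp components (cen e)) ≡ cen e
      spokes≥2   : ∀ {e f} → e ∈ D → f ∈ D → ¬ e ≈ f → cen e ≡ cen f →
                   2 ≤ V.lookup r (StarComponents.comp components (cen e))

  -- G[D] is a disjoint union of stars: once every edge of D has an endpoint chosen as its centre, in
  -- such a way that vertices shared by two edges are centres, the edges with a common centre form
  -- one component.
  module StarForestConstruction {D : List E} (eop : EOP G D) {e₀ : E} (e₀∈ : e₀ ∈ D)
           (cen : E → Fin n) (cen∈ : ∀ e → cen e ∈ₑ e)
           (shared⇒cen : ∀ {e x} → e ∈ D → x ∈ₑ e → Shared D x → cen e ≡ x) where

    leaf : E → Fin n
    leaf e = proj₁ (otherEnd e (cen∈ e))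

    spoke : ∀ e → IsEdge G (cen e) (leaf e) e
    spoke e = proj₂ (otherEnd e (cen∈ e))

    leaf≢cen : ∀ e → leaf e ≢ cen e
    leaf≢cen e eq = IsEdge⇒≢ e (spoke e) (sym eq)

    cen-consistent : ∀ {e f x} → e ∈ D → f ∈ D → x ∈ₑ e → x ∈ₑ f → cen e ≡ cen f
    cen-consistent {e} {f} e∈ f∈ xe xf with e ≈? f
    ... | yes e≈f = cong cen (EOP-≈⇒≡ eop e∈ f∈ e≈f)
    ... | no  e≉f = trans (shared⇒cen e∈ xe sh) (sym (shared⇒cen f∈ xf sh))
      where sh = shared e∈ f∈ e≉f xe xf

    centreOf : Fin n → Fin n
    centreOf x with InV? D x
    ... | yes x∈ = cen (proj₁ (find x∈))
    ... | no  _  = x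

    centreOf-∈ : ∀ {e x} → e ∈ D → x ∈ₑ e → centreOf x ≡ cen e
    centreOf-∈ {e} {x} e∈ xe with InV? D x
    ... | yes x∈ = let (f , f∈ , xf) = find x∈ in cen-consistent f∈ e∈ xf xe
    ... | no  x∉ = ⊥-elim (x∉ (lose e∈ xe))

    Adj⇒centreOf≡ : ∀ {x y} → InV G D x → InV G D y → Adj x y → centreOf x ≡ centreOf y
    Adj⇒centreOf≡ {x} {y} x∈ y∈ xy with find x∈ | find y∈
    ... | e , e∈ , xe | f , f∈ , yf with y ∈ₑ? e | x ∈ₑ? f
    ... | yes ye | _      = trans (centreOf-∈ e∈ xe) (sym (centreOf-∈ e∈ ye))
    ... | no  _  | yes xf = trans (centreOf-∈ f∈ xf) (sym (centreOf-∈ f∈ yf))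
    ... | no  y∉e | no x∉f = ⊥-elim (y∉e (∈-resp-≈ f e (≈-sym e f e≈f) yf))
      where e≈f = EOP-CommonEdge⇒≈ eop e∈ f∈ (x , y , xe , yf , xy , ∉⇒¬IsEdgeʳ e y∉e , ∉⇒¬IsEdgeˡ f x∉f)

    IsCentre : Fin n → Set
    IsCentre c = Any (λ e → cen e ≡ c) D

    IsCentre? : ∀ c → Dec (IsCentre c)
    IsCentre? c = Any.any? (λ e → cen e FP.≟ c) D

    spokesAt : Fin n → List E
    spokesAt c = fibre FP._≟_ cen c D

    spokesAt-∈⁻ : ∀ {c e} → e ∈ spokesAt c → e ∈ D × cen e ≡ c
    spokesAt-∈⁻ = ∈P.∈-filter⁻ (λ e → cen e FP.≟ _)

    spokesAt-∈⁺ : ∀ {c e} → e ∈ D → cen e ≡ c → e ∈ spokesAt c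
    spokesAt-∈⁺ = ∈P.∈-filter⁺ (λ e → cen e FP.≟ _)

    open SortByKey (λ c → length (spokesAt c))
    open DecMembership (FP._≟_ {n}) using (_∈?_)

    allCentres : List (Fin n)
    allCentres = filter IsCentre? (L.allFin n)

    centres : List (Fin n)
    centres = sortByKey allCentres

    allCentres-unique : AllPairs _≢_ allCentres
    allCentres-unique = APP.filter⁺ IsCentre? (APP.tabulate⁺ (λ i≢j → i≢j))

    centres-unique : AllPairs _≢_ centres
    centres-unique = ↭ₛP.AllPairs-resp-↭ (setoid (Fin n)) (λ i≢j j≡i → i≢j (sym j≡i)) (resp₂ _≢_)
                       (↭⇒↭ₛ (↭-sym (sortByKey-↭ allCentres))) allCentres-unique

    centres-∈⁺ : ∀ {c} → IsCentre c → c ∈ centres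
    centres-∈⁺ ic = ↭P.∈-resp-↭ (↭-sym (sortByKey-↭ allCentres)) (∈P.∈-filter⁺ IsCentre? (∈P.∈-allFin _) ic)

    centres-∈⁻ : ∀ {c} → c ∈ centres → IsCentre c
    centres-∈⁻ c∈ = proj₂ (∈P.∈-filter⁻ IsCentre? {xs = L.allFin n} (↭P.∈-resp-↭ (sortByKey-↭ allCentres) c∈))

    s : ℕ
    s = length centres

    cent : Fin s → Fin n
    cent = L.lookup centres

    r : Vec ℕ s
    r = V.tabulate (λ i → length (spokesAt (cent i)))

    r≡ : ∀ i → V.lookup r i ≡ length (spokesAt (cent i))
    r≡ = VP.lookup∘tabulate (λ i → length (spokesAt (cent i)))

    -- Non-centres get the component of the centre of e₀; only centres are ever indexed below.
    index : Fin n → Fin s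
    index c with c ∈? centres
    ... | yes c∈ = Any.index c∈
    ... | no  _  = Any.index (centres-∈⁺ (lose e₀∈ refl))

    cent-index : ∀ {c} → c ∈ centres → cent (index c) ≡ c
    cent-index {c} c∈ with c ∈? centres
    ... | yes c∈′ = sym (AnyP.lookup-index c∈′)
    ... | no  c∉  = ⊥-elim (c∉ c∈)

    index-cent : ∀ i → index (cent i) ≡ i
    index-cent i = AllPairs-lookup-injective (λ i≢j → i≢j) sym centres-unique _ i (cent-index (∈P.∈-lookup i))

    comp : Fin n → Fin s
    comp x = index (centreOf x)

    cent-comp : ∀ {e x} → e ∈ D → x ∈ₑ e → cent (comp x) ≡ cen e
    cent-comp e∈ xe rewrite centreOf-∈ e∈ xe = cent-index (centres-∈⁺ (lose e∈ refl))

    comp-∈ : ∀ {e x} → e ∈ D → x ∈ₑ e → comp x ≡ index (cen e)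
    comp-∈ e∈ xe = cong index (centreOf-∈ e∈ xe)

    centreEdge : ∀ i → ∃[ e ] (e ∈ D × cen e ≡ cent i)
    centreEdge i = find (centres-∈⁻ (∈P.∈-lookup i))

    spokeAt : (i : Fin s) → Fin (V.lookup r i) → E
    spokeAt i k = L.lookup (spokesAt (cent i)) (F.cast (r≡ i) k)

    spokeAt-∈ : ∀ i k → spokeAt i k ∈ D × cen (spokeAt i k) ≡ cent i
    spokeAt-∈ i k = spokesAt-∈⁻ (∈P.∈-lookup _)

    iso : (i : Fin s) → Fin (suc (V.lookup r i)) → Fin n
    iso i F.zero    = cent i
    iso i (F.suc k) = leaf (spokeAt i k)

    comp-spoke : ∀ {e x i} → e ∈ D → x ∈ₑ e → cen e ≡ cent i → comp x ≡ i
    comp-spoke {i = i} e∈ xe ce = trans (comp-∈ e∈ xe) (trans (cong index ce) (index-cent i))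

    iso-in : ∀ i k → InV G D (iso i k) × comp (iso i k) ≡ i
    iso-in i F.zero =
      let (e , e∈ , ce) = centreEdge i
          centre∈e = subst (_∈ₑ e) ce (cen∈ e)
      in lose e∈ centre∈e , comp-spoke {x = cent i} e∈ centre∈e ce
    iso-in i (F.suc k) =
      let (e∈ , ce) = spokeAt-∈ i k
          leaf∈e = IsEdge⇒∈ʳ (spokeAt i k) (spoke (spokeAt i k))
      in lose e∈ leaf∈e , comp-spoke {x = leaf (spokeAt i k)} e∈ leaf∈e ce

    spokes-EOP : ∀ c → EOP G (spokesAt c)
    spokes-EOP c = APP.filter⁺ (λ e → cen e FP.≟ c) eop

    iso-inj : ∀ i k l → iso i k ≡ iso i l → k ≡ l
    iso-inj i F.zero    F.zero    _ = refl
    iso-inj i F.zero    (F.suc l) h = ⊥-elim (leaf≢cen (spokeAt i l) (trans (sym h) (sym (proj₂ (spokeAt-∈ i l)))))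
    iso-inj i (F.suc k) F.zero    h = ⊥-elim (leaf≢cen (spokeAt i k) (trans h (sym (proj₂ (spokeAt-∈ i k)))))
    iso-inj i (F.suc k) (F.suc l) h = cong F.suc (cast-injective (r≡ i)
      (AllPairs-lookup-injective proj₁ (λ {e} {f} → ≈-sym e f) (spokes-EOP (cent i)) _ _ same))
      where
      ek = spokeAt i k
      el = spokeAt i l
      same : ek ≈ el
      same = IsEdge-unique ek el (subst (λ c → IsEdge G c (leaf ek) ek) (proj₂ (spokeAt-∈ i k)) (spoke ek))
                                 (subst₂ (λ c x → IsEdge G c x el) (proj₂ (spokeAt-∈ i l)) (sym h) (spoke el))

    spokeIndex : ∀ {j e} → e ∈ spokesAt (cent j) → ∃[ k ] spokeAt j k ≡ e
    spokeIndex {j} {e} e∈ = F.cast (sym (r≡ j)) (Any.index e∈) , (begin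
      L.lookup (spokesAt (cent j)) (F.cast (r≡ j) (F.cast (sym (r≡ j)) (Any.index e∈)))
        ≡⟨ cong (L.lookup (spokesAt (cent j))) (FP.cast-involutive (r≡ j) (sym (r≡ j)) _) ⟩
      L.lookup (spokesAt (cent j)) (Any.index e∈)
        ≡⟨ sym (AnyP.lookup-index e∈) ⟩
      e ∎)
      where open ≡-Reasoning

    iso-onto : ∀ x → InV G D x → ∃[ k ] iso (comp x) k ≡ x
    iso-onto x x∈ = let (e , e∈ , xe) = find x∈ in onto e∈ xe (IsEdge-endpoint e (spoke e) xe)
      where
      onto : ∀ {e} → e ∈ D → x ∈ₑ e → x ≡ cen e ⊎ x ≡ leaf e → ∃[ k ] iso (comp x) k ≡ x
      onto e∈ xe (inj₁ x≡cen)  = F.zero , trans (cent-comp e∈ xe) (sym x≡cen)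
      onto e∈ xe (inj₂ x≡leaf) =
        let (k , eq) = spokeIndex (spokesAt-∈⁺ e∈ (sym (cent-comp e∈ xe))) in F.suc k , trans (cong leaf eq) (sym x≡leaf)

    leaves-¬Adj : ∀ {e f} → e ∈ D → f ∈ D → cen e ≡ cen f → ¬ Adj (leaf e) (leaf f)
    leaves-¬Adj {e} {f} e∈ f∈ same ll = leaf-f∉e (∈-resp-≈ f e (≈-sym e f e≈f) (IsEdge⇒∈ʳ f (spoke f)))
      where
      leaf-f∉e : ¬ leaf f ∈ₑ e
      leaf-f∉e m with IsEdge-endpoint e (spoke e) m
      ... | inj₁ eq = leaf≢cen f (trans eq same)
      ... | inj₂ eq = irrefl (subst (Adj (leaf e)) eq ll)
      leaf-e∉f : ¬ leaf e ∈ₑ f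
      leaf-e∉f m with IsEdge-endpoint f (spoke f) m
      ... | inj₁ eq = leaf≢cen e (trans eq (sym same))
      ... | inj₂ eq = irrefl (subst (λ z → Adj z (leaf f)) eq ll)
      e≈f = EOP-CommonEdge⇒≈ eop e∈ f∈ (leaf e , leaf f , IsEdge⇒∈ʳ e (spoke e) , IsEdge⇒∈ʳ f (spoke f) , ll ,
                                         ∉⇒¬IsEdgeʳ e leaf-f∉e , ∉⇒¬IsEdgeˡ f leaf-e∉f)

    centre-spoke : ∀ i k → Adj (cent i) (leaf (spokeAt i k))
    centre-spoke i k = subst (λ c → Adj c (leaf (spokeAt i k))) (proj₂ (spokeAt-∈ i k))
                             (IsEdge⇒Adj (spokeAt i k) (spoke (spokeAt i k)))

    iso-adj : ∀ i k l → Adj (iso i k) (iso i l) ⇔ StarAdj G k l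
    iso-adj i F.zero F.zero = mk⇔ (λ a → ⊥-elim (irrefl a))
      (λ { (inj₁ (_ , l≢0)) → ⊥-elim (l≢0 refl) ; (inj₂ (k≢0 , _)) → ⊥-elim (k≢0 refl) })
    iso-adj i F.zero    (F.suc l) = mk⇔ (λ _ → inj₁ (refl , λ ())) (λ _ → centre-spoke i l)
    iso-adj i (F.suc k) F.zero    = mk⇔ (λ _ → inj₂ ((λ ()) , refl)) (λ _ → Adj-sym (centre-spoke i k))
    iso-adj i (F.suc k) (F.suc l) = mk⇔
      (λ a → ⊥-elim (leaves-¬Adj (proj₁ (spokeAt-∈ i k)) (proj₁ (spokeAt-∈ i l))
                                  (trans (proj₂ (spokeAt-∈ i k)) (sym (proj₂ (spokeAt-∈ i l)))) a))
      (λ { (inj₁ (() , _)) ; (inj₂ (_ , ())) })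

    cent∘comp : ∀ {x} → InV G D x → cent (comp x) ≡ centreOf x
    cent∘comp x∈ with find x∈
    ... | e , e∈ , xe = trans (cent-comp e∈ xe) (sym (centreOf-∈ e∈ xe))

    nearCentre : ∀ {x} → InV G D x → (x ≡ centreOf x ⊎ Adj x (centreOf x)) × InV G D (centreOf x)
    nearCentre {x} x∈ with find x∈
    ... | e , e∈ , xe rewrite centreOf-∈ e∈ xe with IsEdge-endpoint e (spoke e) xe
    ...   | inj₁ x≡cen  = inj₁ x≡cen , lose e∈ (cen∈ e)
    ...   | inj₂ refl   = inj₂ (Adj-sym (IsEdge⇒Adj e (spoke e))) , lose e∈ (cen∈ e)

    walk⇒centreOf≡ : ∀ {x y k} → WalkIn G (InV G D) x y k → centreOf x ≡ centreOf y
    walk⇒centreOf≡ (nil _)                          = refl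
    walk⇒centreOf≡ (cons x∈ xy w@(nil y∈))          = Adj⇒centreOf≡ x∈ y∈ xy
    walk⇒centreOf≡ (cons x∈ xy w@(cons y∈ _ _))     = trans (Adj⇒centreOf≡ x∈ y∈ xy) (walk⇒centreOf≡ w)

    centreOf≡⇒walk : ∀ {x y} → InV G D x → InV G D y → centreOf x ≡ centreOf y →
                     ∃[ k ] WalkIn G (InV G D) x y k
    centreOf≡⇒walk {x} {y} x∈ y∈ same with nearCentre x∈ | nearCentre y∈
    ... | x~c , c∈ | y~c , _ = via x~c (fromCentre y~c)
      where
      c = centreOf x
      fromCentre : y ≡ centreOf y ⊎ Adj y (centreOf y) → ∃[ k ] WalkIn G (InV G D) c y k
      fromCentre (inj₁ y≡c) = 0 , subst (λ z → WalkIn G (InV G D) c z 0) (sym (trans y≡c (sym same))) (nil c∈)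
      fromCentre (inj₂ yc)  = 1 , cons c∈ (Adj-sym (subst (Adj y) (sym same) yc)) (nil y∈)
      via : x ≡ c ⊎ Adj x c → ∃[ k ] WalkIn G (InV G D) c y k → ∃[ k ] WalkIn G (InV G D) x y k
      via (inj₁ x≡c) w = subst (λ z → ∃[ k ] WalkIn G (InV G D) z y k) (sym x≡c) w
      via (inj₂ xc)  w = suc (proj₁ w) , cons x∈ xc (proj₂ w)

    sameComp : ∀ x y → InV G D x → InV G D y → (comp x ≡ comp y) ⇔ (∃[ k ] WalkIn G (InV G D) x y k)
    sameComp x y x∈ y∈ = mk⇔
      (λ same → centreOf≡⇒walk x∈ y∈ (trans (sym (cent∘comp x∈)) (trans (cong cent same) (cent∘comp y∈))))
      (λ (_ , w) → cong index (walk⇒centreOf≡ w))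

    components : StarComponents G D s r
    components = record
      { comp = comp ; sameComp = sameComp ; iso = iso ; iso-inj = iso-inj
      ; iso-in = iso-in ; iso-onto = iso-onto ; iso-adj = iso-adj }

    r-positive : ∀ i → 1 ≤ V.lookup r i
    r-positive i with centreEdge i
    ... | e , e∈ , ce = subst (1 ≤_) (sym (r≡ i)) (∈P.∈-length (spokesAt-∈⁺ e∈ ce))

    r-sorted : ∀ i j → i F.≤ j → V.lookup r i ≤ V.lookup r j
    r-sorted i j i≤j = subst₂ _≤_ (sym (r≡ i)) (sym (r≡ j)) (sizes-sorted (ℕP.m≤n⇒m<n∨m≡n i≤j))
      where
      sizes-sorted : i F.< j ⊎ F.toℕ i ≡ F.toℕ j → length (spokesAt (cent i)) ≤ length (spokesAt (cent j))
      sizes-sorted (inj₁ i<j) = AllPairs-lookup-< (sortByKey-sorted allCentres) i<j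
      sizes-sorted (inj₂ i≡j) = ℕP.≤-reflexive (cong (λ k → length (spokesAt (cent k))) (FP.toℕ-injective i≡j))

    r-sum : V.sum r ≡ length D
    r-sum = begin
      V.sum r                                            ≡⟨ sum-tabulate-lookup size centres ⟩
      sum (L.map size centres)                           ≡⟨ sum-↭ (↭P.map⁺ size (sortByKey-↭ allCentres)) ⟩
      sum (L.map size allCentres)                        ≡⟨ sum-fibres FP._≟_ cen allCentres-unique D covered ⟩
      length D                                           ∎
      where
      open ≡-Reasoning
      size : Fin n → ℕ
      size c = length (spokesAt c)
      covered : All (λ e → cen e ∈ allCentres) D
      covered = All.tabulate (λ e∈ → ∈P.∈-filter⁺ IsCentre? (∈P.∈-allFin _) (lose e∈ refl))

    centre-comp : ∀ {e} → e ∈ D → cent (comp (cen e)) ≡ cen e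
    centre-comp {e} e∈ = cent-comp e∈ (cen∈ e)

    spokes≥2 : ∀ {e f} → e ∈ D → f ∈ D → ¬ e ≈ f → cen e ≡ cen f → 2 ≤ V.lookup r (comp (cen e))
    spokes≥2 {e} {f} e∈ f∈ e≉f same = subst (2 ≤_) (sym (trans (r≡ _) (cong (length ∘ spokesAt) (centre-comp e∈))))
      (distinct-∈⇒2≤length (spokesAt-∈⁺ e∈ refl) (spokesAt-∈⁺ f∈ (sym same)) (λ { refl → e≉f (refl , refl) }))

    starForest : StarForest D cen
    starForest = record
      { s = s ; r = r ; r-positive = r-positive ; r-sorted = r-sorted ; r-sum = r-sum
      ; components = components ; centre-comp = centre-comp ; spokes≥2 = spokes≥2 }

  module SharedCentres {L : List E} (eop : EOP G L) where

    cen : E → Fin n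
    cen e with Shared? L (v e)
    ... | yes _ = v e
    ... | no  _ = u e

    cen∈ : ∀ e → cen e ∈ₑ e
    cen∈ e with Shared? L (v e)
    ... | yes _ = inj₂ refl
    ... | no  _ = inj₁ refl

    sharedWithOther : ∀ {x} e → Shared L x → ∃[ f ] (f ∈ L × x ∈ₑ f × ¬ f ≈ e)
    sharedWithOther e sh with Shared⇒∃ sh
    ... | f , g , f∈ , g∈ , f≉g , xf , xg with f ≈? e
    ...   | yes f≈e = g , g∈ , xg , (λ g≈e → f≉g (≈-trans f e g f≈e (≈-sym g e g≈e)))
    ...   | no  f≉e = f , f∈ , xf , f≉e

    -- If both ends of e were shared, e would be a common edge of the two other edges.
    ¬bothShared : ∀ {e} → e ∈ L → Shared L (u e) → Shared L (v e) → ⊥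
    ¬bothShared {e} e∈ shu shv with sharedWithOther e shu | sharedWithOther e shv
    ... | f , f∈ , uf , f≉e | g , g∈ , vg , g≉e =
      f≉e (shared-endpoints⇒≈ f e uf vf (u≢v e) (inj₁ refl) (inj₂ refl))
      where
      f≈g = EOP-CommonEdge⇒≈ eop f∈ g∈ (u e , v e , uf , vg , adj e ,
              (λ i → f≉e (IsEdge-unique f e i (inj₁ (refl , refl)))) ,
              (λ i → g≉e (IsEdge-unique g e i (inj₁ (refl , refl)))))
      vf = ∈-resp-≈ g f (≈-sym f g f≈g) vg

    shared⇒cen : ∀ {e x} → e ∈ L → x ∈ₑ e → Shared L x → cen e ≡ x
    shared⇒cen {e} e∈ xe shx with Shared? L (v e) | xe
    ... | yes shv | inj₁ refl = ⊥-elim (¬bothShared e∈ shx shv)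
    ... | yes _   | inj₂ refl = refl
    ... | no  _   | inj₁ refl = refl
    ... | no  ¬sh | inj₂ refl = ⊥-elim (¬sh shx)

  commonVertex⇒Star : ∀ {L w} → EOP G L → All (w ∈ₑ_) L → HasInducedStar G (length L)
  commonVertex⇒Star {L} {w} eop all = w , ℓ , ℓ-inj , (λ i → IsEdge⇒Adj (edgeAt i) (spokeAt i)) , ℓ-¬Adj
    where
    edgeAt : Fin (length L) → E
    edgeAt = L.lookup L
    other : ∀ i → ∃[ y ] IsEdge G w y (edgeAt i)
    other i = otherEnd (edgeAt i) (All.lookup all (∈P.∈-lookup i))
    ℓ : Fin (length L) → Fin n
    ℓ i = proj₁ (other i)
    spokeAt : ∀ i → IsEdge G w (ℓ i) (edgeAt i)
    spokeAt i = proj₂ (other i)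
    ℓ-inj : ∀ i j → ℓ i ≡ ℓ j → i ≡ j
    ℓ-inj i j h = AllPairs-lookup-injective proj₁ (λ {e} {f} → ≈-sym e f) eop i j
      (IsEdge-unique (edgeAt i) (edgeAt j) (spokeAt i) (subst (λ y → IsEdge G w y (edgeAt j)) (sym h) (spokeAt j)))
    ℓ∉ : ∀ i j → ℓ i ≢ ℓ j → ¬ ℓ j ∈ₑ edgeAt i
    ℓ∉ i j ℓi≢ℓj m with IsEdge-endpoint (edgeAt i) (spokeAt i) m
    ... | inj₁ ℓj≡w  = IsEdge⇒≢ (edgeAt j) (spokeAt j) (sym ℓj≡w)
    ... | inj₂ ℓj≡ℓi = ℓi≢ℓj (sym ℓj≡ℓi)
    ℓ-¬Adj : ∀ i j → ¬ Adj (ℓ i) (ℓ j)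
    ℓ-¬Adj i j a with ℓ i FP.≟ ℓ j
    ... | yes eq    = irrefl (subst (Adj (ℓ i)) (sym eq) a)
    ... | no  ℓi≢ℓj = ℓ∉ i j ℓi≢ℓj (∈-resp-≈ (edgeAt j) (edgeAt i) (≈-sym (edgeAt i) (edgeAt j) e≈f)
                                             (IsEdge⇒∈ʳ (edgeAt j) (spokeAt j)))
      where
      e≈f = EOP-CommonEdge⇒≈ eop (∈P.∈-lookup i) (∈P.∈-lookup j)
              (ℓ i , ℓ j , IsEdge⇒∈ʳ (edgeAt i) (spokeAt i) , IsEdge⇒∈ʳ (edgeAt j) (spokeAt j) , a ,
               ∉⇒¬IsEdgeʳ (edgeAt i) (ℓ∉ i j ℓi≢ℓj) , ∉⇒¬IsEdgeˡ (edgeAt j) (ℓ∉ j i (λ eq → ℓi≢ℓj (sym eq))))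

  module UnsharedPacking {t e D} (c3 : C3 G t) (pe : All (Packed e) D) (eop : EOP G D) (len : length D ≡ t)
                         (¬sh : ∀ x → ¬ Shared (e ∷ D) x) where

    sharedWithHead : ∀ {f x} → f ∈ D → x ∈ₑ e → x ∈ₑ f → ⊥
    sharedWithHead f∈ xe xf = ¬sh _ (shared (here refl) (there f∈) (proj₁ (All.lookup pe f∈)) xe xf)

    u∉ : ¬ InV G D (u e)
    u∉ u∈ = let (f , f∈ , uf) = find u∈ in sharedWithHead f∈ (inj₁ refl) uf

    contradiction : ⊥
    contradiction with c3 D (unshared⇒InducedMatching eop (λ x sh → ¬sh x (Shared-⊆ there sh))) len (u e) u∉
    ... | x , _ , _ , x∈ , _ , ux , _ with find x∈
    ...   | f , f∈ , xf = proj₂ (All.lookup pe f∈)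
            (u e , x , inj₁ refl , xf , ux , (λ i → sharedWithHead f∈ (IsEdge⇒∈ʳ e i) xf)
                                           , (λ i → sharedWithHead f∈ (inj₁ refl) (IsEdge⇒∈ˡ f i)))

  module SharedPacking {t e₁ e₂ D w} (c2 : C2 G t) (c3 : C3 G t) (c4 : C4 G t)
                       (pe : All (Packed e₁) D) (eop : EOP G D) (len : length D ≡ t)
                       (e₂∈ : e₂ ∈ D) (we₁ : w ∈ₑ e₁) (we₂ : w ∈ₑ e₂) where

    a : Fin n
    a = proj₁ (otherEnd e₁ we₁)

    wa : IsEdge G w a e₁
    wa = proj₂ (otherEnd e₁ we₁)

    aw : Adj a w
    aw = Adj-sym (IsEdge⇒Adj e₁ wa)

    e₁≉ : ∀ {f} → f ∈ D → ¬ e₁ ≈ f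
    e₁≉ f∈ = proj₁ (All.lookup pe f∈)

    a∉ : ¬ InV G D a
    a∉ a∈ with find a∈
    ... | f , f∈ , af with w ∈ₑ? f
    ...   | yes wf = e₁≉ f∈ (IsEdge-unique e₁ f wa (endpoints⇒IsEdge f wf af (IsEdge⇒≢ e₁ wa)))
    ...   | no  w∉f = w∉f (∈-resp-≈ e₂ f (≈-sym f e₂ f≈e₂) we₂)
      where
      f≈e₂ = EOP-CommonEdge⇒≈ eop f∈ e₂∈ (a , w , af , we₂ , aw , ∉⇒¬IsEdgeʳ f w∉f ,
               (λ i → e₁≉ e₂∈ (IsEdge-unique e₁ e₂ (IsEdge-sym e₁ wa) i)))

    onlyW : ∀ x → InV G D x → Adj a x → x ≡ w
    onlyW x x∈ ax with x FP.≟ w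
    ... | yes x≡w = x≡w
    ... | no  x≢w with find x∈
    ...   | f , f∈ , xf = ⊥-elim (proj₂ (All.lookup pe f∈)
            (a , x , IsEdge⇒∈ʳ e₁ wa , xf , ax , ∉⇒¬IsEdgeʳ e₁ x∉e₁ , ∉⇒¬IsEdgeˡ f (λ af → a∉ (lose f∈ af))))
      where
      x∉e₁ : ¬ x ∈ₑ e₁
      x∉e₁ m with IsEdge-endpoint e₁ wa m
      ... | inj₁ x≡w = x≢w x≡w
      ... | inj₂ x≡a = irrefl (subst (Adj a) x≡a ax)

    matchingCase : (∀ x → ¬ Shared D x) → ⊥
    matchingCase ¬sh with c3 D (unshared⇒InducedMatching eop ¬sh) len a a∉
    ... | x , y , x≢y , x∈ , y∈ , ax , ay = x≢y (trans (onlyW x x∈ ax) (sym (onlyW y y∈ ay)))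

    starCase : All (w ∈ₑ_) D → ⊥
    starCase all = c2 (suc (length D)) (ℕP.≤-reflexive (cong suc (sym len))) (commonVertex⇒Star {e₁ ∷ D} {w} (pe ∷ eop) (we₁ ∷ all))

    forestCase : ∀ {x₀ g} → Shared D x₀ → g ∈ D → ¬ w ∈ₑ g → ⊥
    forestCase {x₀} {g} sh₀ g∈ w∉g = w′≢ (trans (onlyW w′ w′∈ aw′) (sym centre≡w))
      where
      open SharedCentres {e₁ ∷ D} (pe ∷ eop)
      open StarForest (StarForestConstruction.starForest eop e₂∈ cen cen∈
                         (λ e∈ xe sh → shared⇒cen (there e∈) xe (Shared-⊆ there sh)))
      open StarComponents components
      j : Fin s
      j = comp (cen e₂)
      centre≡w : centre j ≡ w
      centre≡w = trans (centre-comp {e₂} e₂∈) (shared⇒cen {e₂} (there e₂∈) we₂ (shared (here refl) (there e₂∈) (e₁≉ e₂∈) we₁ we₂))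
      s≥2 : 2 ≤ s
      s≥2 = 2≤-of-distinct {i = j} {comp (cen g)} λ same →
        w∉g (subst (_∈ₑ g) (trans (sym (centre-comp g∈)) (trans (cong centre (sym same)) centre≡w)) (cen∈ g))
      sameCentre : ∀ {f f′ x} → f ∈ D → f′ ∈ D → x ∈ₑ f → x ∈ₑ f′ → Shared D x → cen f ≡ cen f′
      sameCentre f∈ f′∈ xf xf′ sh = trans (shared⇒cen (there f∈) xf shL) (sym (shared⇒cen (there f′∈) xf′ shL))
        where shL = Shared-⊆ there sh
      s<t : suc s ≤ t
      s<t = let (f , f′ , f∈ , f′∈ , f≉f′ , x₀f , x₀f′) = Shared⇒∃ sh₀ in
        subst (suc s ≤_) (trans r-sum len)
              (suc-length≤sum r r-positive _ (spokes≥2 f∈ f′∈ f≉f′ (sameCentre f∈ f′∈ x₀f x₀f′ sh₀)))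
      outcome = c4 (ℕP.≤-trans (s≤s s≥2) s<t) s s≥2 (ℕP.pred-mono-≤ s<t) r r-positive r-sorted (trans r-sum len)
                   D eop len components j a a∉ (subst (Adj a) (sym centre≡w) aw)
      w′ = proj₁ outcome
      w′∈ = proj₁ (proj₂ outcome)
      w′≢ = proj₁ (proj₂ (proj₂ outcome))
      aw′ = proj₂ (proj₂ (proj₂ outcome))

    contradiction : ⊥
    contradiction with FP.any? (Shared? D)
    ... | no ¬sh = matchingCase (λ x sh → ¬sh (x , sh))
    ... | yes (x₀ , sh₀) with Any.any? (λ g → ¬? (w ∈ₑ? g)) D
    ...   | yes outside = let (g , g∈ , w∉g) = find outside in forestCase sh₀ g∈ w∉g
    ...   | no  none    = starCase (All.tabulate λ {g} g∈ →
                             decidable-stable (w ∈ₑ? g) (λ w∉g → none (lose g∈ w∉g)))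

  unsharedPacking : ∀ {t D} → C3 G t → EOP G D → length D ≡ suc t → (∀ x → ¬ Shared D x) → ⊥
  unsharedPacking {D = _ ∷ _} c3 (pe ∷ eop) len ¬sh =
    UnsharedPacking.contradiction c3 pe eop (ℕP.suc-injective len) ¬sh

  sharedPacking : ∀ {t D w} → C2 G t → C3 G t → C4 G t → EOP G D → length D ≡ suc t → Shared D w → ⊥
  sharedPacking c2 c3 c4 eop len sh with Shared⇒∃ sh
  ... | e₁ , e₂ , e₁∈ , e₂∈ , e₁≉e₂ , we₁ , we₂ with ∈⇒↭-front e₁∈
  ...   | D′ , D↭ with EOP-resp-↭ D↭ eop | ↭P.∈-resp-↭ D↭ e₂∈
  ...     | _  ∷ _    | here refl  = e₁≉e₂ (refl , refl)
  ...     | pe ∷ eop′ | there e₂∈′ =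
    SharedPacking.contradiction {e₁ = e₁} {e₂} c2 c3 c4 pe eop′
      (ℕP.suc-injective (trans (sym (↭P.↭-length D↭)) len)) e₂∈′ we₁ we₂

  noPacking : ∀ {t D} → C2 G t → C3 G t → C4 G t → EOP G D → length D ≡ suc t → ⊥
  noPacking {D = D} c2 c3 c4 eop len with FP.any? (Shared? D)
  ... | yes (_ , sh) = sharedPacking c2 c3 c4 eop len sh
  ... | no  ¬sh      = unsharedPacking c3 eop len (λ x sh → ¬sh (x , sh))

  PackingBound-of-conditions : ∀ {t} → C2 G t → C3 G t → C4 G t → PackingBound G t
  PackingBound-of-conditions {t} c2 c3 c4 D eop with length D ℕ.≤? t
  ... | yes ≤t = ≤t
  ... | no  ≰t = ⊥-elim (noPacking c2 c3 c4 (APP.take⁺ (suc t) eop)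
                          (trans (LP.length-take (suc t) D) (ℕP.m≤n⇒m⊓n≡m (ℕP.≰⇒> ≰t))))

theorem2p3 : (G : Graph) → Connected G → (t : ℕ) → 2 ≤ t →
    RhoBetween G 2 t ⇔ (C1 G t × C2 G t × C3 G t × C4 G t)
theorem2p3 G conn t t≥2 = mk⇔ necessary sufficient
  where
  open Necessity G
  open Sufficiency G
  necessary : RhoBetween G 2 t → C1 G t × C2 G t × C3 G t × C4 G t
  necessary (two , bound) =
    (DiamGe-of-packing two , DiamLe-of-bound conn t bound) ,
    C2-of-bound bound , C3-of-bound conn (ℕP.≤-trans (s≤s z≤n) t≥2) bound , C4-of-bound bound
  sufficient : C1 G t × C2 G t × C3 G t × C4 G t → RhoBetween G 2 t
  sufficient ((diam≥2 , _) , c2 , c3 , c4) =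
    packing-of-DiamGe conn diam≥2 , PackingBound-of-conditions c2 c3 c4
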